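{- Let $q$ be a prime power and $n$ a positive integer. Let $L_W$ be an $\mathbb{F}_q$-linear set in $\mathrm{PG}(1,q^n)$ of rank $k\le n$ admitting two points with complementary weights of type $(k-r,r)$. Then $L_W$ is $\mathrm{PGL}(2,q^n)$-equivalent to $L_U$ with $U=S\times T$, where $S$ is a $(k-r)$-dimensional $\mathbb{F}_q$-subspace of $\mathbb{F}_{q^n}$ and $T$ is an $r$-dimensional $\mathbb{F}_q$-subspace of $\mathbb{F}_{q^n}$ with $1\in T$.
   Context: For an $\mathbb{F}_q$-subspace $U\neq\{0\}$ of $\mathbb{F}_{q^n}^2$, $L_U=\{\langle u\rangle_{\mathbb{F}_{q^n}}: u\in U\setminus\{0\}\}\subseteq\mathrm{PG}(1,q^n)$ has rank $\dim_{\mathbb{F}_q}U$; the weight of $P=\langle v\rangle_{\mathbb{F}_{q^n}}$ in $L_U$ is $\dim_{\mathbb{F}_q}(U\cap\langle v\rangle_{\mathbb{F}_{q^n}})$. A linear set of rank $k$ has complementary weights of type $(k-r,r)$ if it contains two distinct points of weights $k-r$ and $r$, with $k-r\ge r$. For $S,T\subseteq\mathbb{F}_{q^n}$, $S\times T=\{(s,t):s\in S,t\in T\}$. -}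

module Defs where

open import Level using (0ℓ)
open import Data.Nat using (ℕ; zero; suc; _≤_; _^_)
open import Data.Nat.Primality using (Prime)
open import Data.Fin using (Fin; zero; suc)
open import Data.Product using (Σ; ∃; ∃-syntax; _×_; _,_)
open import Data.Unit using (⊤)
open import Relation.Nullary using (¬_)
open import Relation.Binary.PropositionalEquality using (_≡_)
open import Algebra.Bundles using (CommutativeRing)

IsPrimePower : ℕ → Set
IsPrimePower q = ∃[ p ] ∃[ e ] (Prime p × 1 ≤ e × q ≡ p ^ e)

module _ (R : CommutativeRing 0ℓ 0ℓ) where
  open CommutativeRing R hiding (zero)

  IsField : Set
  IsField = ¬ (1# ≈ 0#) × (∀ x → ¬ (x ≈ 0#) → ∃[ y ] (x * y ≈ 1#))

  HasSize : ℕ → (Carrier → Set) → Set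
  HasSize m P = Σ (Fin m → Carrier) λ f →
    (∀ i → P (f i)) × (∀ i j → f i ≈ f j → i ≡ j) × (∀ x → P x → ∃[ i ] (x ≈ f i))

  IsSubfield : (Carrier → Set) → Set
  IsSubfield K =
    (∀ {x y} → x ≈ y → K x → K y) × K 0# × K 1# ×
    (∀ {x y} → K x → K y → K (x + y)) × (∀ {x} → K x → K (- x)) ×
    (∀ {x y} → K x → K y → K (x * y)) ×
    (∀ {x y} → K x → ¬ (x ≈ 0#) → x * y ≈ 1# → K y)

module Geometry (R : CommutativeRing 0ℓ 0ℓ) (K : CommutativeRing.Carrier R → Set) where
  open CommutativeRing R hiding (zero)

  module VS {V : Set} (_≈ᵥ_ : V → V → Set) (_+ᵥ_ : V → V → V) (0ᵥ : V)
            (_·_ : Carrier → V → V) where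

    IsSubspace : (V → Set) → Set
    IsSubspace U = (∀ {x y} → x ≈ᵥ y → U x → U y) × U 0ᵥ ×
                   (∀ {x y} → U x → U y → U (x +ᵥ y)) ×
                   (∀ {a x} → K a → U x → U (a · x))

    lincomb : (d : ℕ) → (Fin d → Carrier) → (Fin d → V) → V
    lincomb zero c b = 0ᵥ
    lincomb (suc d) c b = (c zero · b zero) +ᵥ lincomb d (λ i → c (suc i)) (λ i → b (suc i))

    HasDim : (V → Set) → ℕ → Set
    HasDim U d = Σ (Fin d → V) λ b →
      (∀ i → U (b i)) ×
      (∀ c → (∀ i → K (c i)) → lincomb d c b ≈ᵥ 0ᵥ → ∀ i → c i ≈ 0#) ×
      (∀ u → U u → ∃[ c ] ((∀ i → K (c i)) × u ≈ᵥ lincomb d c b))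

  module V₁ = VS _≈_ _+_ 0# _*_

  Pair : Set
  Pair = Carrier × Carrier

  _≈₂_ : Pair → Pair → Set
  (a , b) ≈₂ (c , d) = (a ≈ c) × (b ≈ d)

  _+₂_ : Pair → Pair → Pair
  (a , b) +₂ (c , d) = (a + c , b + d)

  0₂ : Pair
  0₂ = (0# , 0#)

  _·₂_ : Carrier → Pair → Pair
  λ' ·₂ (a , b) = (λ' * a , λ' * b)

  module V₂ = VS _≈₂_ _+₂_ 0₂ _·₂_

  ⟨_⟩ : Pair → Pair → Set
  ⟨ v ⟩ x = ∃[ λ' ] (x ≈₂ (λ' ·₂ v))

  IsPointOf : (Pair → Set) → Pair → Set
  IsPointOf W v = ∃[ u ] (W u × ¬ (u ≈₂ 0₂) × ⟨ v ⟩ u)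

  HasWeight : (Pair → Set) → Pair → ℕ → Set
  HasWeight W v w = V₂.HasDim (λ x → W x × ⟨ v ⟩ x) w

  -- 2x2 matrices over F_{q^n}: (a , b , c , d) = [[a , b] , [c , d]]
  Mat : Set
  Mat = Carrier × Carrier × Carrier × Carrier

  apply : Mat → Pair → Pair
  apply (a , b , c , d) (x , y) = (a * x + b * y , c * x + d * y)

  Invertible : Mat → Set
  Invertible (a , b , c , d) = ¬ ((a * d + - (b * c)) ≈ 0#)

  PGLEquiv : (Pair → Set) → (Pair → Set) → Set
  PGLEquiv W U = Σ Mat λ A → Invertible A ×
    (∀ w → W w → ¬ (w ≈₂ 0₂) → ∃[ u ] (U u × ¬ (u ≈₂ 0₂) × ⟨ u ⟩ (apply A w))) ×
    (∀ u → U u → ¬ (u ≈₂ 0₂) → ∃[ w ] (W w × ¬ (w ≈₂ 0₂) × ⟨ u ⟩ (apply A w)))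

  _×ₛ_ : (Carrier → Set) → (Carrier → Set) → Pair → Set
  (S ×ₛ T) (x , y) = S x × T y

-- Let v and w be the points of weights k - r and r, and u a nonzero vector of W on the line ⟨w⟩.
-- As ⟨v⟩ ≠ ⟨w⟩, v and u are a basis of F_{q^n}^2 and the matrix sending them to (1,0) and (0,1)
-- is invertible. Put S = {α : α v ∈ W} and T = {β : β u ∈ W}; their dimensions are the weights
-- of the two points, and 1 ∈ T. The subspaces W ∩ ⟨v⟩ and W ∩ ⟨u⟩ meet trivially and have
-- dimensions adding up to k = dim W, so W = S v ⊕ T u, by counting over the finite field F_q.
-- The matrix therefore maps W onto S × T.
module Submission where

open import Defs
open import Level using (0ℓ)
open import Algebra.Bundles using (CommutativeRing)
open import Data.Nat as ℕ using (ℕ; zero; suc; _≤_; _^_; _∸_)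
import Data.Nat.Properties as ℕ
open import Data.Integer as ℤ using (ℤ; +_; -[1+_]; _⊖_)
import Data.Integer.Properties as ℤ
open import Data.Fin as Fin using (Fin; zero; suc; combine; quotient; remainder; punchOut; funToFin; finToFun)
open import Data.Fin.Properties
  using (any?; pigeonhole; punchOut-injective; <-irrefl; combine-remQuot; funToFin-finToFin; finToFun-funToFin)
open import Data.Maybe using (just; nothing)
open import Data.Product using (∃; ∃₂; ∃-syntax; _×_; _,_; proj₁; proj₂)
open import Data.Product.Relation.Binary.Pointwise.NonDependent using (×-setoid)
open import Relation.Binary.Bundles using (Setoid)
open import Data.Unit using (⊤)
open import Function using (_∘_; Injective)
open import Relation.Nullary using (¬_; Dec; yes; no)
open import Relation.Nullary.Negation using (contradiction)
open import Relation.Binary.Definitions using (WeaklyDecidable)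
open import Relation.Binary.PropositionalEquality as ≡ using (_≡_; _≗_)
import Algebra.Solver.Ring.AlmostCommutativeRing as ACR
import Relation.Binary.Reasoning.Setoid as SetoidReasoning

-- Over an abstract ring the normal forms of Tactic.RingSolver do not compute (its coefficients are
-- ring elements), so Algebra.Solver.Ring is instantiated with ℤ and the canonical map ℤ → R.
module IntegerCoefficientSolver {c ℓ} (R : CommutativeRing c ℓ) where
  open CommutativeRing R
  open import Algebra.Properties.Ring ring using (-‿distribˡ-*; -‿distribʳ-*; -0#≈0#; -‿involutive)
  open import Algebra.Properties.Semiring.Mult semiring using (×-homo-+; ×1-homo-*) renaming (_×_ to _×ₙ_)
  open import Algebra.Properties.AbelianGroup +-abelianGroup using (⁻¹-∙-comm)
  open SetoidReasoning setoid

  ι : ℤ → Carrier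
  ι (+ n)    = n ×ₙ 1#
  ι -[1+ n ] = - (suc n ×ₙ 1#)

  ι-neg : ∀ i → ι (ℤ.- i) ≈ - ι i
  ι-neg -[1+ n ]  = sym (-‿involutive _)
  ι-neg (+ zero)  = sym -0#≈0#
  ι-neg (+ suc n) = refl

  ι-⊖ : ∀ m n → ι (m ⊖ n) ≈ m ×ₙ 1# - n ×ₙ 1#
  ι-⊖ m       zero    = sym (trans (+-congˡ -0#≈0#) (+-identityʳ _))
  ι-⊖ zero    (suc n) = sym (+-identityˡ _)
  ι-⊖ (suc m) (suc n) = begin
    ι (suc m ⊖ suc n)       ≡⟨ ≡.cong ι (ℤ.[1+m]⊖[1+n]≡m⊖n m n) ⟩
    ι (m ⊖ n)               ≈⟨ ι-⊖ m n ⟩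
    a - b                   ≈⟨ +-congʳ (sym (+-identityˡ a)) ⟩
    (0# + a) - b            ≈⟨ +-congʳ (+-congʳ (sym (-‿inverseʳ 1#))) ⟩
    ((1# - 1#) + a) - b     ≈⟨ +-congʳ (+-assoc 1# (- 1#) a) ⟩
    (1# + (- 1# + a)) - b   ≈⟨ +-congʳ (+-congˡ (+-comm (- 1#) a)) ⟩
    (1# + (a - 1#)) - b     ≈⟨ +-congʳ (sym (+-assoc 1# a (- 1#))) ⟩
    ((1# + a) - 1#) - b     ≈⟨ +-assoc (1# + a) (- 1#) (- b) ⟩
    (1# + a) + (- 1# - b)   ≈⟨ +-congˡ (⁻¹-∙-comm 1# b) ⟩
    (1# + a) - (1# + b)     ∎
    where a = m ×ₙ 1#; b = n ×ₙ 1#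

  ι-+ : ∀ i j → ι (i ℤ.+ j) ≈ ι i + ι j
  ι-+ (+ m)    (+ n)    = ×-homo-+ 1# m n
  ι-+ (+ m)    -[1+ n ] = ι-⊖ m (suc n)
  ι-+ -[1+ m ] (+ n)    = trans (ι-⊖ n (suc m)) (+-comm _ _)
  ι-+ -[1+ m ] -[1+ n ] = sym (begin
    - (suc m ×ₙ 1#) - (suc n ×ₙ 1#)  ≈⟨ ⁻¹-∙-comm _ _ ⟩
    - (suc m ×ₙ 1# + suc n ×ₙ 1#)    ≈⟨ -‿cong (sym (×-homo-+ 1# (suc m) (suc n))) ⟩
    - ((suc m ℕ.+ suc n) ×ₙ 1#)     ≡⟨ ≡.cong (λ k → - (k ×ₙ 1#)) (ℕ.+-suc (suc m) n) ⟩
    - (suc (suc m ℕ.+ n) ×ₙ 1#)     ∎)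

  ι-*⁺ : ∀ m j → ι (+ m ℤ.* j) ≈ ι (+ m) * ι j
  ι-*⁺ m (+ n)    = trans (reflexive (≡.cong ι (≡.sym (ℤ.pos-* m n)))) (×1-homo-* m n)
  ι-*⁺ m -[1+ n ] = begin
    ι (+ m ℤ.* -[1+ n ])        ≡⟨ ≡.cong ι (≡.sym (ℤ.neg-distribʳ-* (+ m) (+ suc n))) ⟩
    ι (ℤ.- (+ m ℤ.* + suc n))   ≈⟨ ι-neg (+ m ℤ.* + suc n) ⟩
    - ι (+ m ℤ.* + suc n)       ≈⟨ -‿cong (ι-*⁺ m (+ suc n)) ⟩
    - (ι (+ m) * ι (+ suc n))   ≈⟨ -‿distribʳ-* _ _ ⟩
    ι (+ m) * ι -[1+ n ]        ∎

  ι-* : ∀ i j → ι (i ℤ.* j) ≈ ι i * ι j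
  ι-* (+ m)    j = ι-*⁺ m j
  ι-* -[1+ m ] j = begin
    ι (-[1+ m ] ℤ.* j)        ≡⟨ ≡.cong ι (≡.sym (ℤ.neg-distribˡ-* (+ suc m) j)) ⟩
    ι (ℤ.- (+ suc m ℤ.* j))   ≈⟨ ι-neg (+ suc m ℤ.* j) ⟩
    - ι (+ suc m ℤ.* j)       ≈⟨ -‿cong (ι-*⁺ (suc m) j) ⟩
    - (ι (+ suc m) * ι j)     ≈⟨ -‿distribˡ-* _ _ ⟩
    ι -[1+ m ] * ι j          ∎

  ι-homomorphism : ℤ.+-*-rawRing ACR.-Raw-AlmostCommutative⟶ ACR.fromCommutativeRing R
  ι-homomorphism = record
    { ⟦_⟧ = ι ; +-homo = ι-+ ; *-homo = ι-* ; -‿homo = ι-neg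
    ; 0-homo = refl ; 1-homo = +-identityʳ 1# }

  ι-weaklyDecidable : WeaklyDecidable (ACR.Induced-equivalence ι-homomorphism)
  ι-weaklyDecidable i j with i ℤ.≟ j
  ... | yes ≡.refl = just refl
  ... | no _       = nothing

  open import Algebra.Solver.Ring ℤ.+-*-rawRing (ACR.fromCommutativeRing R) ι-homomorphism ι-weaklyDecidable public

module _ where
  open ≡ using (refl; sym; trans; cong; cong₂)

  injective⇒surjective : ∀ {n} (f : Fin n → Fin n) → Injective _≡_ _≡_ f → ∀ y → ∃ λ x → f x ≡ y
  injective⇒surjective {suc n} f inj y with any? (λ x → f x Fin.≟ y)
  ... | yes hit = hit
  ... | no miss with pigeonhole (ℕ.n<1+n n) (λ x → punchOut {i = y} {j = f x} (miss ∘ (x ,_) ∘ sym))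
  ... | i , j , i<j , eq =
    contradiction (inj (punchOut-injective (miss ∘ (i ,_) ∘ sym) (miss ∘ (j ,_) ∘ sym) eq)) (λ i≡j → <-irrefl i≡j i<j)

  funToFin-cong : ∀ {m n} {f g : Fin m → Fin n} → f ≗ g → funToFin f ≡ funToFin g
  funToFin-cong {zero}  eq = refl
  funToFin-cong {suc m} eq = cong₂ combine (eq zero) (funToFin-cong (eq ∘ suc))

  funToFin-injective : ∀ {m n} {f g : Fin m → Fin n} → funToFin f ≡ funToFin g → f ≗ g
  funToFin-injective {f = f} {g} eq i =
    trans (sym (finToFun-funToFin f i)) (trans (cong (λ x → finToFun x i) eq) (finToFun-funToFin g i))

  finToFun-injective : ∀ {m n} {x y : Fin (n ^ m)} → finToFun {n} {m} x ≗ finToFun y → x ≡ y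
  finToFun-injective {m} {n} {x} {y} eq =
    trans (sym (funToFin-finToFin {m} {n} x)) (trans (funToFin-cong eq) (funToFin-finToFin {m} {n} y))

  injective-on-tuples⇒surjective :
    ∀ {q m r k} → m ℕ.+ r ≡ k → (Φ : (Fin m → Fin q) → (Fin r → Fin q) → Fin k → Fin q) →
    (∀ {a b a′ b′} → Φ a b ≗ Φ a′ b′ → a ≗ a′ × b ≗ b′) →
    ∀ c → ∃₂ λ a b → Φ a b ≗ c
  injective-on-tuples⇒surjective {q} {m} {r} {k} m+r≡k Φ Φ-injective c =
    let x , Ψx≡c = Ψ-surjective (funToFin c) in a x , b x , funToFin-injective Ψx≡c
    where
    a : Fin (q ^ m ℕ.* q ^ r) → Fin m → Fin q
    a x = finToFun (quotient (q ^ r) x)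
    b : Fin (q ^ m ℕ.* q ^ r) → Fin r → Fin q
    b x = finToFun (remainder {q ^ m} (q ^ r) x)
    Ψ : Fin (q ^ m ℕ.* q ^ r) → Fin (q ^ k)
    Ψ x = funToFin (Φ (a x) (b x))
    Ψ-injective : Injective _≡_ _≡_ Ψ
    Ψ-injective {x} {y} Ψx≡Ψy =
      let a≗ , b≗ = Φ-injective {a x} {b x} {a y} {b y} (funToFin-injective Ψx≡Ψy) in
      trans (sym (combine-remQuot {q ^ m} (q ^ r) x))
        (trans (cong₂ combine (finToFun-injective {m} {q} a≗) (finToFun-injective {r} {q} b≗))
               (combine-remQuot {q ^ m} (q ^ r) y))
    sizes : q ^ m ℕ.* q ^ r ≡ q ^ k
    sizes = trans (sym (ℕ.^-distribˡ-+-* q m r)) (cong (q ^_) m+r≡k)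
    Ψ-surjective : ∀ y → ∃ λ x → Ψ x ≡ y
    Ψ-surjective = transport sizes Ψ Ψ-injective
      where
      transport : ∀ {s t} → s ≡ t → (f : Fin s → Fin t) → Injective _≡_ _≡_ f → ∀ y → ∃ λ x → f x ≡ y
      transport refl = injective⇒surjective

module _ (R : CommutativeRing 0ℓ 0ℓ) where
  open CommutativeRing R

  HasSize⇒≈-decidable : ∀ {m P} → HasSize R m P → ∀ {x y} → P x → P y → Dec (x ≈ y)
  HasSize⇒≈-decidable (_ , _ , enum-injective , enum-surjective) Px Py
    with enum-surjective _ Px | enum-surjective _ Py
  ... | i , x≈i | j , y≈j with i Fin.≟ j
  ...   | yes ≡.refl = yes (trans x≈i (sym y≈j))
  ...   | no i≢j    = no (λ x≈y → i≢j (enum-injective i j (trans (sym x≈i) (trans x≈y y≈j))))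

module PlaneOverRing (R : CommutativeRing 0ℓ 0ℓ) (K : CommutativeRing.Carrier R → Set) where
  open CommutativeRing R hiding (zero)
  open Geometry R K
  open IntegerCoefficientSolver R using (solve; _:=_; _:+_; _:*_)

  pairSetoid : Setoid 0ℓ 0ℓ
  pairSetoid = ×-setoid setoid setoid

  open Setoid pairSetoid public using ()
    renaming (refl to ≈₂-refl; sym to ≈₂-sym; trans to ≈₂-trans)
  module ≈₂-Reasoning = SetoidReasoning pairSetoid

  +₂-cong : ∀ {x x′ y y′} → x ≈₂ x′ → y ≈₂ y′ → (x +₂ y) ≈₂ (x′ +₂ y′)
  +₂-cong (e₁ , e₂) (f₁ , f₂) = +-cong e₁ f₁ , +-cong e₂ f₂

  ·₂-cong : ∀ {a b x y} → a ≈ b → x ≈₂ y → (a ·₂ x) ≈₂ (b ·₂ y)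
  ·₂-cong e (f₁ , f₂) = *-cong e f₁ , *-cong e f₂

  ·₂-assoc : ∀ a b x → ((a * b) ·₂ x) ≈₂ (a ·₂ (b ·₂ x))
  ·₂-assoc a b (x₁ , x₂) = *-assoc a b x₁ , *-assoc a b x₂

  ·₂-identityˡ : ∀ x → (1# ·₂ x) ≈₂ x
  ·₂-identityˡ (x₁ , x₂) = *-identityˡ x₁ , *-identityˡ x₂

  ·₂-zeroˡ : ∀ x → (0# ·₂ x) ≈₂ 0₂
  ·₂-zeroˡ (x₁ , x₂) = zeroˡ x₁ , zeroˡ x₂

  ·₂-zeroʳ : ∀ a {x} → x ≈₂ 0₂ → (a ·₂ x) ≈₂ 0₂
  ·₂-zeroʳ a (z₁ , z₂) = trans (*-congˡ z₁) (zeroʳ a) , trans (*-congˡ z₂) (zeroʳ a)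

  ·₂-distribʳ : ∀ a b x → ((a + b) ·₂ x) ≈₂ ((a ·₂ x) +₂ (b ·₂ x))
  ·₂-distribʳ a b (x₁ , x₂) = distribʳ x₁ a b , distribʳ x₂ a b

  +₂-identityˡ : ∀ x → (0₂ +₂ x) ≈₂ x
  +₂-identityˡ (x₁ , x₂) = +-identityˡ x₁ , +-identityˡ x₂

  lincomb-cong : ∀ d {c c′ b b′} → (∀ i → c i ≈ c′ i) → (∀ i → b i ≈₂ b′ i) →
                 V₂.lincomb d c b ≈₂ V₂.lincomb d c′ b′
  lincomb-cong zero    ec eb = ≈₂-refl
  lincomb-cong (suc d) ec eb = +₂-cong (·₂-cong (ec zero) (eb zero)) (lincomb-cong d (ec ∘ suc) (eb ∘ suc))

  lincomb-+ : ∀ d c c′ b → (V₂.lincomb d c b +₂ V₂.lincomb d c′ b) ≈₂ V₂.lincomb d (λ i → c i + c′ i) b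
  lincomb-+ zero    c c′ b = +₂-identityˡ 0₂
  lincomb-+ (suc d) c c′ b =
    ≈₂-trans (shuffle _ _ _ _) (+₂-cong (≈₂-sym (·₂-distribʳ _ _ _)) (lincomb-+ d (c ∘ suc) (c′ ∘ suc) (b ∘ suc)))
    where
    interchange : ∀ x y z w → (x + y) + (z + w) ≈ (x + z) + (y + w)
    interchange = solve 4 (λ x y z w → (x :+ y) :+ (z :+ w) := (x :+ z) :+ (y :+ w)) refl
    shuffle : ∀ x y z w → ((x +₂ y) +₂ (z +₂ w)) ≈₂ ((x +₂ z) +₂ (y +₂ w))
    shuffle x y z w = interchange _ _ _ _ , interchange _ _ _ _

  lincomb-zero : ∀ d {c} b → (∀ i → c i ≈ 0#) → V₂.lincomb d c b ≈₂ 0₂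
  lincomb-zero zero    b z = ≈₂-refl
  lincomb-zero (suc d) b z =
    ≈₂-trans (+₂-cong (≈₂-trans (·₂-cong (z zero) ≈₂-refl) (·₂-zeroˡ (b zero))) (lincomb-zero d (b ∘ suc) (z ∘ suc)))
             (+₂-identityˡ 0₂)

  lincomb-onLine : ∀ d c {b} s p → (∀ i → b i ≈₂ (s i ·₂ p)) → V₂.lincomb d c b ≈₂ (V₁.lincomb d c s ·₂ p)
  lincomb-onLine zero    c s p eb = ≈₂-sym (·₂-zeroˡ p)
  lincomb-onLine (suc d) c {b} s p eb = begin
    (c zero ·₂ b zero) +₂ V₂.lincomb d (c ∘ suc) (b ∘ suc)
      ≈⟨ +₂-cong (·₂-cong refl (eb zero)) (lincomb-onLine d (c ∘ suc) (s ∘ suc) p (eb ∘ suc)) ⟩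
    (c zero ·₂ (s zero ·₂ p)) +₂ (l ·₂ p)
      ≈⟨ +₂-cong (≈₂-sym (·₂-assoc _ _ p)) ≈₂-refl ⟩
    ((c zero * s zero) ·₂ p) +₂ (l ·₂ p)
      ≈⟨ ≈₂-sym (·₂-distribʳ _ _ p) ⟩
    (c zero * s zero + l) ·₂ p
      ∎
    where
    open ≈₂-Reasoning
    l : Carrier
    l = V₁.lincomb d (c ∘ suc) (s ∘ suc)

  lincomb-∈ : ∀ {U} → V₂.IsSubspace U → ∀ d {c b} → (∀ i → K (c i)) → (∀ i → U (b i)) → U (V₂.lincomb d c b)
  lincomb-∈ (_ , U0 , _ , _)     zero    Kc Ub = U0
  lincomb-∈ U@(_ , _ , U+ , U·) (suc d) Kc Ub = U+ (U· (Kc zero) (Ub zero)) (lincomb-∈ U d (Kc ∘ suc) (Ub ∘ suc))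

  ⟨⟩-isSubspace : ∀ p → V₂.IsSubspace ⟨ p ⟩
  ⟨⟩-isSubspace p =
      (λ x≈y (λ′ , x≈λ′p) → λ′ , ≈₂-trans (≈₂-sym x≈y) x≈λ′p)
    , (0# , ≈₂-sym (·₂-zeroˡ p))
    , (λ (λ′ , x≈) (μ , y≈) → λ′ + μ , ≈₂-trans (+₂-cong x≈ y≈) (≈₂-sym (·₂-distribʳ λ′ μ p)))
    , (λ {a} _ (λ′ , x≈) → a * λ′ , ≈₂-trans (·₂-cong refl x≈) (≈₂-sym (·₂-assoc a λ′ p)))

  ∩-isSubspace : ∀ {U V} → V₂.IsSubspace U → V₂.IsSubspace V → V₂.IsSubspace (λ x → U x × V x)
  ∩-isSubspace (c , z , s , m) (c′ , z′ , s′ , m′) =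
    (λ e (a , b) → c e a , c′ e b) , (z , z′) , (λ (a , b) (a′ , b′) → s a a′ , s′ b b′) , (λ k (a , b) → m k a , m′ k b)

  ⟨⟩-trans : ∀ {x p p′} → ⟨ p ⟩ x → ⟨ p′ ⟩ p → ⟨ p′ ⟩ x
  ⟨⟩-trans {p′ = p′} (λ′ , x≈) (μ , p≈) = λ′ * μ , ≈₂-trans x≈ (≈₂-trans (·₂-cong refl p≈) (≈₂-sym (·₂-assoc λ′ μ p′)))

  ⟨⟩-generator-nonzero : ∀ {x p} → ¬ x ≈₂ 0₂ → ⟨ p ⟩ x → ¬ p ≈₂ 0₂
  ⟨⟩-generator-nonzero x≉0 (λ′ , x≈) p≈0 = x≉0 (≈₂-trans x≈ (·₂-zeroʳ λ′ p≈0))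

  HasDim-cong : ∀ {P Q d} → (∀ {x} → P x → Q x) → (∀ {x} → Q x → P x) → V₂.HasDim P d → V₂.HasDim Q d
  HasDim-cong P⇒Q Q⇒P (b , Pb , independent , spans) = b , P⇒Q ∘ Pb , independent , λ u → spans u ∘ Q⇒P

  Independent : (d : ℕ) → (Fin d → Pair) → Set
  Independent d b = ∀ c → (∀ i → K (c i)) → V₂.lincomb d c b ≈₂ 0₂ → ∀ i → c i ≈ 0#

  lineCoefficients : (Pair → Set) → Pair → Carrier → Set
  lineCoefficients W p α = W (α ·₂ p)

  lineCoefficients-isSubspace : ∀ {W} → V₂.IsSubspace W → ∀ p → V₁.IsSubspace (lineCoefficients W p)
  lineCoefficients-isSubspace (Wc , W0 , W+ , W·) p =
      (λ e → Wc (·₂-cong e ≈₂-refl))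
    , Wc (≈₂-sym (·₂-zeroˡ p)) W0
    , (λ Wa Wb → Wc (≈₂-sym (·₂-distribʳ _ _ p)) (W+ Wa Wb))
    , (λ Ka Wb → Wc (≈₂-sym (·₂-assoc _ _ p)) (W· Ka Wb))

  scalar-nonzero : ∀ {x λ′ p} → ¬ x ≈₂ 0₂ → x ≈₂ (λ′ ·₂ p) → ¬ λ′ ≈ 0#
  scalar-nonzero {p = p} x≉0 x≈ λ′≈0 = x≉0 (≈₂-trans x≈ (≈₂-trans (·₂-cong λ′≈0 ≈₂-refl) (·₂-zeroˡ p)))

  apply-cong : ∀ A {x y} → x ≈₂ y → apply A x ≈₂ apply A y
  apply-cong A (e₁ , e₂) = +-cong (*-congˡ e₁) (*-congˡ e₂) , +-cong (*-congˡ e₁) (*-congˡ e₂)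

module PlaneOverField (R : CommutativeRing 0ℓ 0ℓ) (isField : IsField R)
  (_≟_ : ∀ x y → Dec (CommutativeRing._≈_ R x y)) (K : CommutativeRing.Carrier R → Set) where
  open CommutativeRing R hiding (zero)
  open Geometry R K
  open PlaneOverRing R K
  open IntegerCoefficientSolver R using (solve; _:=_; _:+_; _:*_; :-_; _:-_)
  open import Algebra.Properties.Group +-group using (x∙y⁻¹≈ε⇒x≈y)
  open import Data.Sum using (_⊎_; inj₁; inj₂)
  module ≈-Reasoning = SetoidReasoning setoid

  infix 30 _⁻¹⟨_⟩
  _⁻¹⟨_⟩ : ∀ x → ¬ x ≈ 0# → Carrier
  x ⁻¹⟨ x≉0 ⟩ = proj₁ (proj₂ isField x x≉0)

  *-inverseʳ : ∀ x x≉0 → x * x ⁻¹⟨ x≉0 ⟩ ≈ 1#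
  *-inverseʳ x x≉0 = proj₂ (proj₂ isField x x≉0)

  *-inverseˡ : ∀ x x≉0 → x ⁻¹⟨ x≉0 ⟩ * x ≈ 1#
  *-inverseˡ x x≉0 = trans (*-comm _ x) (*-inverseʳ x x≉0)

  *-cancelˡ : ∀ {a x y} → ¬ a ≈ 0# → a * x ≈ a * y → x ≈ y
  *-cancelˡ {a} {x} {y} a≉0 ax≈ay = begin
    x                       ≈⟨ sym (*-identityˡ x) ⟩
    1# * x                  ≈⟨ *-congʳ (sym (*-inverseˡ a a≉0)) ⟩
    (a ⁻¹⟨ a≉0 ⟩ * a) * x   ≈⟨ *-assoc _ a x ⟩
    a ⁻¹⟨ a≉0 ⟩ * (a * x)   ≈⟨ *-congˡ ax≈ay ⟩
    a ⁻¹⟨ a≉0 ⟩ * (a * y)   ≈⟨ sym (*-assoc _ a y) ⟩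
    (a ⁻¹⟨ a≉0 ⟩ * a) * y   ≈⟨ *-congʳ (*-inverseˡ a a≉0) ⟩
    1# * y                  ≈⟨ *-identityˡ y ⟩
    y                       ∎
    where open ≈-Reasoning

  proportional : ∀ {a b x y} (a≉0 : ¬ a ≈ 0#) → a * y ≈ b * x → y ≈ (b * a ⁻¹⟨ a≉0 ⟩) * x
  proportional {a} {b} {x} {y} a≉0 ay≈bx = *-cancelˡ a≉0 (begin
    a * y                          ≈⟨ ay≈bx ⟩
    b * x                          ≈⟨ *-congʳ (sym (trans (*-congˡ (*-inverseʳ a a≉0)) (*-identityʳ b))) ⟩
    (b * (a * a ⁻¹⟨ a≉0 ⟩)) * x    ≈⟨ rearrange b a (a ⁻¹⟨ a≉0 ⟩) x ⟩
    a * ((b * a ⁻¹⟨ a≉0 ⟩) * x)    ∎)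
    where
    open ≈-Reasoning
    rearrange : ∀ b a i x → (b * (a * i)) * x ≈ a * ((b * i) * x)
    rearrange = solve 4 (λ b a i x → (b :* (a :* i)) :* x := a :* ((b :* i) :* x)) refl

  nonzero-component : ∀ {p} → ¬ p ≈₂ 0₂ → ¬ proj₁ p ≈ 0# ⊎ ¬ proj₂ p ≈ 0#
  nonzero-component {p₁ , p₂} p≉0 with p₁ ≟ 0# | p₂ ≟ 0#
  ... | no p₁≉0 | _        = inj₁ p₁≉0
  ... | yes _   | no p₂≉0  = inj₂ p₂≉0
  ... | yes p₁≈0 | yes p₂≈0 = contradiction (p₁≈0 , p₂≈0) p≉0

  ·₂-cancelʳ : ∀ {a b p} → ¬ p ≈₂ 0₂ → (a ·₂ p) ≈₂ (b ·₂ p) → a ≈ b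
  ·₂-cancelʳ {a} {b} {p₁ , p₂} p≉0 (e₁ , e₂) with nonzero-component p≉0
  ... | inj₁ p₁≉0 = *-cancelˡ p₁≉0 (trans (*-comm p₁ a) (trans e₁ (*-comm b p₁)))
  ... | inj₂ p₂≉0 = *-cancelˡ p₂≉0 (trans (*-comm p₂ a) (trans e₂ (*-comm b p₂)))

  ⟨⟩-sym : ∀ {x p} → ¬ x ≈₂ 0₂ → ⟨ p ⟩ x → ⟨ x ⟩ p
  ⟨⟩-sym {x} {p} x≉0 (λ′ , x≈λ′p) = λ′ ⁻¹⟨ λ′≉0 ⟩ , ≈₂-sym (begin
    λ′ ⁻¹⟨ λ′≉0 ⟩ ·₂ x              ≈⟨ ·₂-cong refl x≈λ′p ⟩
    λ′ ⁻¹⟨ λ′≉0 ⟩ ·₂ (λ′ ·₂ p)      ≈⟨ ≈₂-sym (·₂-assoc _ λ′ p) ⟩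
    (λ′ ⁻¹⟨ λ′≉0 ⟩ * λ′) ·₂ p       ≈⟨ ·₂-cong (*-inverseˡ λ′ λ′≉0) ≈₂-refl ⟩
    1# ·₂ p                         ≈⟨ ·₂-identityˡ p ⟩
    p                               ∎)
    where
    λ′≉0 : ¬ λ′ ≈ 0#
    λ′≉0 = scalar-nonzero x≉0 x≈λ′p
    open ≈₂-Reasoning

  weight⇒lineCoefficients-dim : ∀ {W p d} → V₂.IsSubspace W → ¬ p ≈₂ 0₂ → HasWeight W p d →
                                V₁.HasDim (lineCoefficients W p) d
  weight⇒lineCoefficients-dim {W} {p} {d} (Wc , _) p≉0 (e , We , independent , spans) =
    s , (λ i → Wc (e≈sp i) (proj₁ (We i))) , independent′ , spans′
    where
    s : Fin d → Carrier
    s i = proj₁ (proj₂ (We i))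
    e≈sp : ∀ i → e i ≈₂ (s i ·₂ p)
    e≈sp i = proj₂ (proj₂ (We i))
    independent′ : ∀ c → (∀ i → K (c i)) → V₁.lincomb d c s ≈ 0# → ∀ i → c i ≈ 0#
    independent′ c Kc cs≈0 = independent c Kc
      (≈₂-trans (lincomb-onLine d c s p e≈sp) (≈₂-trans (·₂-cong cs≈0 ≈₂-refl) (·₂-zeroˡ p)))
    spans′ : ∀ α → W (α ·₂ p) → ∃[ c ] ((∀ i → K (c i)) × α ≈ V₁.lincomb d c s)
    spans′ α Wαp =
      let c , Kc , αp≈ce = spans (α ·₂ p) (Wαp , α , ≈₂-refl)
      in  c , Kc , ·₂-cancelʳ p≉0 (≈₂-trans αp≈ce (lincomb-onLine d c s p e≈sp))

  det : Pair → Pair → Carrier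
  det (v₁ , v₂) (u₁ , u₂) = v₁ * u₂ - u₁ * v₂

  det≈0⇒⟨⟩ : ∀ {v u} → ¬ v ≈₂ 0₂ → det v u ≈ 0# → ⟨ v ⟩ u
  det≈0⇒⟨⟩ {v₁ , v₂} {u₁ , u₂} v≉0 det≈0 = witness (nonzero-component v≉0)
    where
    v₁u₂≈u₁v₂ : v₁ * u₂ ≈ u₁ * v₂
    v₁u₂≈u₁v₂ = x∙y⁻¹≈ε⇒x≈y _ _ det≈0
    witness : ¬ v₁ ≈ 0# ⊎ ¬ v₂ ≈ 0# → ⟨ v₁ , v₂ ⟩ (u₁ , u₂)
    witness (inj₁ v₁≉0) = u₁ * v₁ ⁻¹⟨ v₁≉0 ⟩ , proportional v₁≉0 (*-comm v₁ u₁) , proportional v₁≉0 v₁u₂≈u₁v₂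
    witness (inj₂ v₂≉0) = u₂ * v₂ ⁻¹⟨ v₂≉0 ⟩
      , proportional v₂≉0 (trans (*-comm v₂ u₁) (trans (sym v₁u₂≈u₁v₂) (*-comm v₁ u₂)))
      , proportional v₂≉0 (*-comm v₂ u₂)

  module CoordinatesAlong (v u : Pair) (v≉0 : ¬ v ≈₂ 0₂) (u∉⟨v⟩ : ¬ ⟨ v ⟩ u) where
    private
      v₁ v₂ u₁ u₂ : Carrier
      v₁ = proj₁ v
      v₂ = proj₂ v
      u₁ = proj₁ u
      u₂ = proj₂ u

    det≉0 : ¬ det v u ≈ 0#
    det≉0 = u∉⟨v⟩ ∘ det≈0⇒⟨⟩ v≉0

    private
      δ : Carrier
      δ = det v u ⁻¹⟨ det≉0 ⟩
      det·δ≈1 : det v u * δ ≈ 1#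
      det·δ≈1 = *-inverseʳ (det v u) det≉0

    -- the inverse of the matrix with columns v and u
    toCoordinates : Mat
    toCoordinates = (u₂ * δ , (- u₁) * δ , (- v₂) * δ , v₁ * δ)

    toCoordinates-correct : ∀ σ τ → apply toCoordinates ((σ ·₂ v) +₂ (τ ·₂ u)) ≈₂ (σ , τ)
    toCoordinates-correct σ τ =
        trans (first-coordinate σ τ v₁ v₂ u₁ u₂ δ) (trans (*-congˡ det·δ≈1) (*-identityʳ σ))
      , trans (second-coordinate σ τ v₁ v₂ u₁ u₂ δ) (trans (*-congˡ det·δ≈1) (*-identityʳ τ))
      where
      first-coordinate : ∀ σ τ v₁ v₂ u₁ u₂ δ →
        (u₂ * δ) * (σ * v₁ + τ * u₁) + ((- u₁) * δ) * (σ * v₂ + τ * u₂) ≈ σ * ((v₁ * u₂ - u₁ * v₂) * δ)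
      first-coordinate = solve 7 (λ σ τ v₁ v₂ u₁ u₂ δ →
        (u₂ :* δ) :* (σ :* v₁ :+ τ :* u₁) :+ ((:- u₁) :* δ) :* (σ :* v₂ :+ τ :* u₂)
          := σ :* ((v₁ :* u₂ :- u₁ :* v₂) :* δ)) refl
      second-coordinate : ∀ σ τ v₁ v₂ u₁ u₂ δ →
        ((- v₂) * δ) * (σ * v₁ + τ * u₁) + (v₁ * δ) * (σ * v₂ + τ * u₂) ≈ τ * ((v₁ * u₂ - u₁ * v₂) * δ)
      second-coordinate = solve 7 (λ σ τ v₁ v₂ u₁ u₂ δ →
        ((:- v₂) :* δ) :* (σ :* v₁ :+ τ :* u₁) :+ (v₁ :* δ) :* (σ :* v₂ :+ τ :* u₂)
          := τ :* ((v₁ :* u₂ :- u₁ :* v₂) :* δ)) refl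

    -- its determinant is δ = 1 / det v u
    toCoordinates-invertible : Invertible toCoordinates
    toCoordinates-invertible detA≈0 = proj₁ isField (begin
      1#                 ≈⟨ sym det·δ≈1 ⟩
      det v u * δ        ≈⟨ *-congˡ δ≈0 ⟩
      det v u * 0#       ≈⟨ zeroʳ _ ⟩
      0#                 ∎)
      where
      open ≈-Reasoning
      determinant : ∀ v₁ v₂ u₁ u₂ δ →
        (u₂ * δ) * (v₁ * δ) - ((- u₁) * δ) * ((- v₂) * δ) ≈ δ * ((v₁ * u₂ - u₁ * v₂) * δ)
      determinant = solve 5 (λ v₁ v₂ u₁ u₂ δ →
        (u₂ :* δ) :* (v₁ :* δ) :- ((:- u₁) :* δ) :* ((:- v₂) :* δ)
          := δ :* ((v₁ :* u₂ :- u₁ :* v₂) :* δ)) refl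
      δ≈0 : δ ≈ 0#
      δ≈0 = trans (sym (*-identityʳ δ)) (trans (*-congˡ (sym det·δ≈1)) (trans (sym (determinant v₁ v₂ u₁ u₂ δ)) detA≈0))

    coordinates-unique : ∀ {σ τ σ′ τ′} → ((σ ·₂ v) +₂ (τ ·₂ u)) ≈₂ ((σ′ ·₂ v) +₂ (τ′ ·₂ u)) → σ ≈ σ′ × τ ≈ τ′
    coordinates-unique {σ} {τ} {σ′} {τ′} eq =
      ≈₂-trans (≈₂-sym (toCoordinates-correct σ τ))
               (≈₂-trans (apply-cong toCoordinates eq) (toCoordinates-correct σ′ τ′))

    toCoordinates-onto-lineCoefficients :
      ∀ {W} → V₂.IsSubspace W →
      (∀ {x} → W x → ∃₂ λ σ τ → W (σ ·₂ v) × W (τ ·₂ u) × x ≈₂ ((σ ·₂ v) +₂ (τ ·₂ u))) →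
      PGLEquiv W (lineCoefficients W v ×ₛ lineCoefficients W u)
    toCoordinates-onto-lineCoefficients {W} (_ , _ , W+ , _) decompose =
      toCoordinates , toCoordinates-invertible , forward , backward
      where
      zero-sum : ((0# ·₂ v) +₂ (0# ·₂ u)) ≈₂ 0₂
      zero-sum = ≈₂-trans (+₂-cong (·₂-zeroˡ v) (·₂-zeroˡ u)) (+₂-identityˡ 0₂)
      forward : ∀ x → W x → ¬ x ≈₂ 0₂ →
                ∃[ y ] ((lineCoefficients W v ×ₛ lineCoefficients W u) y × ¬ y ≈₂ 0₂ × ⟨ y ⟩ (apply toCoordinates x))
      forward x Wx x≉0 =
        let σ , τ , Wσv , Wτu , x≈ = decompose Wx
        in  (σ , τ) , (Wσv , Wτu)
          , (λ (σ≈0 , τ≈0) → x≉0 (≈₂-trans x≈ (≈₂-trans (+₂-cong (·₂-cong σ≈0 ≈₂-refl) (·₂-cong τ≈0 ≈₂-refl)) zero-sum)))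
          , 1# , ≈₂-trans (apply-cong toCoordinates x≈) (≈₂-trans (toCoordinates-correct σ τ) (≈₂-sym (·₂-identityˡ (σ , τ))))
      backward : ∀ y → (lineCoefficients W v ×ₛ lineCoefficients W u) y → ¬ y ≈₂ 0₂ →
                 ∃[ x ] (W x × ¬ x ≈₂ 0₂ × ⟨ y ⟩ (apply toCoordinates x))
      backward (σ , τ) (Wσv , Wτu) y≉0 =
        (σ ·₂ v) +₂ (τ ·₂ u) , W+ Wσv Wτu
        , (λ x≈0 → y≉0 (coordinates-unique (≈₂-trans x≈0 (≈₂-sym zero-sum))))
        , 1# , ≈₂-trans (toCoordinates-correct σ τ) (≈₂-sym (·₂-identityˡ (σ , τ)))

module FiniteSubfield (R : CommutativeRing 0ℓ 0ℓ) (K : CommutativeRing.Carrier R → Set) (isSubfield : IsSubfield R K)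
  {q : ℕ} (K-size : HasSize R q K) where
  open CommutativeRing R hiding (zero)
  open Geometry R K
  open PlaneOverRing R K
  open import Algebra.Properties.Group +-group using (x∙y⁻¹≈ε⇒x≈y)

  private
    K-+ : ∀ {x y} → K x → K y → K (x + y)
    K-+ = proj₁ (proj₂ (proj₂ (proj₂ isSubfield)))
    K-neg : ∀ {x} → K x → K (- x)
    K-neg = proj₁ (proj₂ (proj₂ (proj₂ (proj₂ isSubfield))))

  enum : Fin q → Carrier
  enum = proj₁ K-size

  enum-∈ : ∀ i → K (enum i)
  enum-∈ = proj₁ (proj₂ K-size)

  enum-injective : ∀ {i j} → enum i ≈ enum j → i ≡ j
  enum-injective = proj₁ (proj₂ (proj₂ K-size)) _ _

  index : ∀ {x} → K x → Fin q
  index Kx = proj₁ (proj₂ (proj₂ (proj₂ K-size)) _ Kx)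

  enum-index : ∀ {x} (Kx : K x) → x ≈ enum (index Kx)
  enum-index Kx = proj₂ (proj₂ (proj₂ (proj₂ K-size)) _ Kx)

  lincomb-injective : ∀ d {b} → Independent d b → ∀ {c c′} → (∀ i → K (c i)) → (∀ i → K (c′ i)) →
                      V₂.lincomb d c b ≈₂ V₂.lincomb d c′ b → ∀ i → c i ≈ c′ i
  lincomb-injective d {b} independent {c} {c′} Kc Kc′ eq i =
    x∙y⁻¹≈ε⇒x≈y _ _ (independent (λ j → c j - c′ j) (λ j → K-+ (Kc j) (K-neg (Kc′ j))) difference≈0 i)
    where
    open ≈₂-Reasoning
    difference≈0 : V₂.lincomb d (λ j → c j - c′ j) b ≈₂ 0₂
    difference≈0 = begin
      V₂.lincomb d (λ j → c j - c′ j) b                      ≈⟨ ≈₂-sym (lincomb-+ d c (λ j → - c′ j) b) ⟩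
      V₂.lincomb d c b +₂ V₂.lincomb d (λ j → - c′ j) b      ≈⟨ +₂-cong eq ≈₂-refl ⟩
      V₂.lincomb d c′ b +₂ V₂.lincomb d (λ j → - c′ j) b     ≈⟨ lincomb-+ d c′ (λ j → - c′ j) b ⟩
      V₂.lincomb d (λ j → c′ j - c′ j) b                     ≈⟨ lincomb-zero d b (λ j → -‿inverseʳ (c′ j)) ⟩
      0₂                                                     ∎

  enum-lincomb-injective : ∀ d {b} → Independent d b → ∀ {a a′} →
                           V₂.lincomb d (enum ∘ a) b ≈₂ V₂.lincomb d (enum ∘ a′) b → a ≗ a′
  enum-lincomb-injective d independent eq i =
    enum-injective (lincomb-injective d independent (enum-∈ ∘ _) (enum-∈ ∘ _) eq i)

  module _ {W k} (W-dim : V₂.HasDim W k) where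
    private
      b : Fin k → Pair
      b = proj₁ W-dim

    coordinates : ∀ {x} → W x → Fin k → Fin q
    coordinates Wx i = index (proj₁ (proj₂ (proj₂ (proj₂ (proj₂ W-dim)) _ Wx)) i)

    coordinates-correct : ∀ {x} (Wx : W x) → x ≈₂ V₂.lincomb k (enum ∘ coordinates Wx) b
    coordinates-correct Wx =
      let _ , Kc , x≈cb = proj₂ (proj₂ (proj₂ W-dim)) _ Wx
      in  ≈₂-trans x≈cb (lincomb-cong k (enum-index ∘ Kc) (λ _ → ≈₂-refl))

  module DirectSum {W} (W-subspace : V₂.IsSubspace W) {v u}
    (coordinates-unique : ∀ {σ τ σ′ τ′} → ((σ ·₂ v) +₂ (τ ·₂ u)) ≈₂ ((σ′ ·₂ v) +₂ (τ′ ·₂ u)) → σ ≈ σ′ × τ ≈ τ′)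
    where

    components-unique : ∀ {y z y′ z′} → ⟨ v ⟩ y → ⟨ u ⟩ z → ⟨ v ⟩ y′ → ⟨ u ⟩ z′ →
                        (y +₂ z) ≈₂ (y′ +₂ z′) → y ≈₂ y′ × z ≈₂ z′
    components-unique (σ , y≈) (τ , z≈) (σ′ , y′≈) (τ′ , z′≈) eq =
      let σ≈σ′ , τ≈τ′ = coordinates-unique (≈₂-trans (≈₂-sym (+₂-cong y≈ z≈)) (≈₂-trans eq (+₂-cong y′≈ z′≈)))
      in  ≈₂-trans y≈ (≈₂-trans (·₂-cong σ≈σ′ ≈₂-refl) (≈₂-sym y′≈))
        , ≈₂-trans z≈ (≈₂-trans (·₂-cong τ≈τ′ ≈₂-refl) (≈₂-sym z′≈))

    -- Counting: the q^m * q^r sums y + z with y ∈ W ∩ ⟨v⟩ and z ∈ W ∩ ⟨u⟩ are distinct, so they exhaust the q^k vectors of W.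
    decompose : ∀ {k m r} → m ℕ.+ r ≡ k → V₂.HasDim W k → HasWeight W v m → HasWeight W u r →
                ∀ {x} → W x → ∃₂ λ σ τ → W (σ ·₂ v) × W (τ ·₂ u) × x ≈₂ ((σ ·₂ v) +₂ (τ ·₂ u))
    decompose {k} {m} {r} m+r≡k W-dim (e , e∈ , e-independent , _) (f , f∈ , f-independent , _) {x} Wx =
      let a , a′ , Φaa′≗ = injective-on-tuples⇒surjective m+r≡k Φ Φ-injective (coordinates W-dim Wx)
          Wy , σ , y≈σv = onV-∈ a
          Wz , τ , z≈τu = onU-∈ a′
          x≈y+z = ≈₂-trans (coordinates-correct W-dim Wx)
                    (≈₂-trans (lincomb-cong k (λ i → reflexive (≡.cong enum (≡.sym (Φaa′≗ i)))) (λ _ → ≈₂-refl))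
                              (≈₂-sym (Φ-correct a a′)))
      in  σ , τ , Wc y≈σv Wy , Wc z≈τu Wz , ≈₂-trans x≈y+z (+₂-cong y≈σv z≈τu)
      where
      Wc : ∀ {y z} → y ≈₂ z → W y → W z
      Wc = proj₁ W-subspace
      W+ : ∀ {y z} → W y → W z → W (y +₂ z)
      W+ = proj₁ (proj₂ (proj₂ W-subspace))
      onV : (Fin m → Fin q) → Pair
      onV a = V₂.lincomb m (enum ∘ a) e
      onU : (Fin r → Fin q) → Pair
      onU a′ = V₂.lincomb r (enum ∘ a′) f
      onV-∈ : ∀ a → W (onV a) × ⟨ v ⟩ (onV a)
      onV-∈ a = lincomb-∈ (∩-isSubspace W-subspace (⟨⟩-isSubspace v)) m (enum-∈ ∘ a) e∈
      onU-∈ : ∀ a′ → W (onU a′) × ⟨ u ⟩ (onU a′)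
      onU-∈ a′ = lincomb-∈ (∩-isSubspace W-subspace (⟨⟩-isSubspace u)) r (enum-∈ ∘ a′) f∈
      Φ : (Fin m → Fin q) → (Fin r → Fin q) → Fin k → Fin q
      Φ a a′ = coordinates W-dim (W+ (proj₁ (onV-∈ a)) (proj₁ (onU-∈ a′)))
      Φ-correct : ∀ a a′ → (onV a +₂ onU a′) ≈₂ V₂.lincomb k (enum ∘ Φ a a′) (proj₁ W-dim)
      Φ-correct a a′ = coordinates-correct W-dim _
      Φ-injective : ∀ {a a′ c c′} → Φ a a′ ≗ Φ c c′ → a ≗ c × a′ ≗ c′
      Φ-injective {a} {a′} {c} {c′} Φ≗ =
        let sums≈ = ≈₂-trans (Φ-correct a a′)
                      (≈₂-trans (lincomb-cong k (λ i → reflexive (≡.cong enum (Φ≗ i))) (λ _ → ≈₂-refl))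
                                (≈₂-sym (Φ-correct c c′)))
            y≈ , z≈ = components-unique (proj₂ (onV-∈ a)) (proj₂ (onU-∈ a′)) (proj₂ (onV-∈ c)) (proj₂ (onU-∈ c′)) sums≈
        in  enum-lincomb-injective m e-independent y≈ , enum-lincomb-injective r f-independent z≈

proposition3p3 : (q n : ℕ) → IsPrimePower q → 1 ≤ n →
    (R : CommutativeRing 0ℓ 0ℓ) → IsField R → HasSize R (q ^ n) (λ _ → ⊤) →
    (K : CommutativeRing.Carrier R → Set) → IsSubfield R K → HasSize R q K →
    let open CommutativeRing R in
    let open Geometry R K in
    (W : Pair → Set) → V₂.IsSubspace W →
    (k r : ℕ) → V₂.HasDim W k → k ≤ n → r ≤ k ∸ r →
    (v w : Pair) → IsPointOf W v → IsPointOf W w → ¬ (⟨ v ⟩ w) →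
    HasWeight W v (k ∸ r) → HasWeight W w r →
    ∃[ S ] ∃[ T ]
      (V₁.IsSubspace S × V₁.HasDim S (k ∸ r) ×
       V₁.IsSubspace T × V₁.HasDim T r × T 1# ×
       PGLEquiv W (S ×ₛ T))
proposition3p3 q n _ _ R isField R-size K isSubfield K-size W W-subspace k r W-dim _ r≤k∸r v w
  (_ , _ , x≉0 , v∋x) (u , Wu , u≉0 , w∋u) w∉⟨v⟩ v-weight w-weight =
  lineCoefficients W v , lineCoefficients W u ,
  lineCoefficients-isSubspace W-subspace v , weight⇒lineCoefficients-dim W-subspace v≉0 v-weight ,
  lineCoefficients-isSubspace W-subspace u , weight⇒lineCoefficients-dim W-subspace u≉0 u-weight ,
  proj₁ W-subspace (≈₂-sym (·₂-identityˡ u)) Wu ,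
  toCoordinates-onto-lineCoefficients W-subspace
    (decompose (ℕ.m∸n+n≡m (ℕ.≤-trans r≤k∸r (ℕ.m∸n≤m k r))) W-dim v-weight u-weight)
  where
  open CommutativeRing R hiding (zero)
  open Geometry R K
  open PlaneOverRing R K
  open PlaneOverField R isField (λ x y → HasSize⇒≈-decidable R R-size {x = x} {y} _ _) K
  open FiniteSubfield R K isSubfield K-size
  v≉0 : ¬ v ≈₂ 0₂
  v≉0 = ⟨⟩-generator-nonzero x≉0 v∋x
  u∋w : ⟨ u ⟩ w
  u∋w = ⟨⟩-sym u≉0 w∋u
  u∉⟨v⟩ : ¬ ⟨ v ⟩ u
  u∉⟨v⟩ v∋u = w∉⟨v⟩ (⟨⟩-trans u∋w v∋u)
  u-weight : HasWeight W u r
  u-weight = HasDim-cong (λ (Wx , w∋x) → Wx , ⟨⟩-trans w∋x u∋w) (λ (Wx , u∋x) → Wx , ⟨⟩-trans u∋x w∋u) w-weight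
  open CoordinatesAlong v u v≉0 u∉⟨v⟩
  open DirectSum W-subspace coordinates-unique
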